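{- For each integer $s\ge 1$, if $n\ge \operatorname{Ram}(3,4;s^2)$, then $\operatorname{ldim}(1,2;n)>s$.
   Context: For integers $2\le d<n$, $P(1,d;n)$ is the poset consisting of all $1$-element and all $d$-element subsets of $\{1,\dots,n\}$ ordered by inclusion, and $\operatorname{ldim}(1,d;n)$ denotes its local dimension. $\operatorname{Ram}(k,h;r)$ denotes the least positive integer $N$ such that for every $n\ge N$ and every coloring of the $k$-element subsets of $\{1,\dots,n\}$ with $r$ colors there is an $h$-element subset all of whose $k$-element subsets receive the same color. A partial linear extension (ple) of a poset $P$ is a linear extension of a subposet of $P$. For a family $\mathcal{L}$ of ple's, $\mu(u,\mathcal{L})$ is the number of members containing $u$ and $\mu(\mathcal{L})=\max_u\mu(u,\mathcal{L})$. A non-empty family $\mathcal{L}$ is a local realizer of $P$ if (1) whenever $x\le y$ in $P$ some $L\in\mathcal{L}$ has $x\le y$ in $L$, and (2) whenever $x\parallel y$ in $P$ some $L\in\mathcal{L}$ has $x>y$ in $L$. The local dimension of $P$ is the minimum of $\mu(\mathcal{L})$ over local realizers $\mathcal{L}$. -}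

module Defs where

open import Data.Nat as ℕ using (ℕ; _≤_; _<_)
import Data.Nat.Properties as ℕP
open import Data.Fin as Fin using (Fin; toℕ)
import Data.Fin.Properties as FinP
open import Data.Fin.Subset using (Subset; _⊆_; ∣_∣)
open import Data.List using (List; length; lookup; filter)
open import Data.List.Relation.Unary.Unique.Propositional using (Unique)
open import Data.List.Membership.Propositional using (_∈_)
import Data.List.Membership.DecPropositional as DecMem
open import Data.Product using (Σ; ∃; _×_; _,_)
open import Data.Sum using (_⊎_)
open import Data.Empty using (⊥)
open import Relation.Nullary using (¬_; Dec; yes; no)
open import Relation.Binary.PropositionalEquality using (_≡_; refl; cong)
open import Relation.Binary.Definitions using (DecidableEquality)

Colouring : (n k r : ℕ) → Set
Colouring n k r = (A : Subset n) → ∣ A ∣ ≡ k → Fin r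

HasMonoSet : (n k h r : ℕ) → Colouring n k r → Set
HasMonoSet n k h r c =
  Σ (Subset n) λ H → ∣ H ∣ ≡ h × Σ (Fin r) λ col →
    (A : Subset n) (p : ∣ A ∣ ≡ k) → A ⊆ H → c A p ≡ col

RamseyProp : (k h r N : ℕ) → Set
RamseyProp k h r N =
  (n : ℕ) → N ≤ n → (c : Colouring n k r) → HasMonoSet n k h r c

IsRam : (k h r N : ℕ) → Set
IsRam k h r N =
  1 ≤ N × RamseyProp k h r N × ((M : ℕ) → 1 ≤ M → RamseyProp k h r M → N ≤ M)

-- The poset P(1,2;n): 1-element and 2-element subsets of [n]

data Elem (n : ℕ) : Set where
  pt : Fin n → Elem n
  pr : (i j : Fin n) → i Fin.< j → Elem n

_≤P_ : ∀ {n} → Elem n → Elem n → Set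
pt i ≤P pt j = i ≡ j
pt i ≤P pr j k _ = i ≡ j ⊎ i ≡ k
pr _ _ _ ≤P pt _ = ⊥
pr i j _ ≤P pr k l _ = i ≡ k × j ≡ l

_∥P_ : ∀ {n} → Elem n → Elem n → Set
x ∥P y = ¬ (x ≤P y) × ¬ (y ≤P x)

_≟E_ : ∀ {n} → DecidableEquality (Elem n)
pt i ≟E pt j with i FinP.≟ j
... | yes refl = yes refl
... | no ne = no λ { refl → ne refl }
pt _ ≟E pr _ _ _ = no λ ()
pr _ _ _ ≟E pt _ = no λ ()
pr i j p ≟E pr k l q with i FinP.≟ k | j FinP.≟ l
... | yes refl | yes refl = yes (cong (pr i j) (ℕP.<-irrelevant p q))
... | no ne | _ = no λ { refl → ne refl }
... | _ | no ne = no λ { refl → ne refl }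

_≤[_]_ : ∀ {n} → Elem n → List (Elem n) → Elem n → Set
x ≤[ L ] y = Σ (Fin (length L)) λ i → Σ (Fin (length L)) λ j →
  toℕ i ≤ toℕ j × lookup L i ≡ x × lookup L j ≡ y

record PLE (n : ℕ) : Set where
  field
    elems  : List (Elem n)
    unique : Unique elems
    extends : ∀ x y → x ∈ elems → y ∈ elems → x ≤P y → x ≤[ elems ] y
open PLE public

μ : ∀ {n} → Elem n → List (PLE n) → ℕ
μ {n} u 𝓛 = length (filter (λ L → u ∈? elems L) 𝓛)
  where open DecMem (_≟E_ {n}) using (_∈?_)

record LocalRealizer {n : ℕ} (𝓛 : List (PLE n)) : Set where
  field
    nonEmpty : 1 ≤ length 𝓛
    realizes≤ : ∀ x y → x ≤P y → Σ (PLE n) λ L → L ∈ 𝓛 × x ≤[ elems L ] y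
    realizes∥ : ∀ x y → x ∥P y → Σ (PLE n) λ L → L ∈ 𝓛 × y ≤[ elems L ] x

-- ldim(1,2;n) > s : every local realizer 𝓛 has μ(𝓛) = max_u μ(u,𝓛) > s
ldim12> : ℕ → ℕ → Set
ldim12> n s = (𝓛 : List (PLE n)) → LocalRealizer 𝓛 → ∃ λ u → s < μ u 𝓛

-- Suppose every element of P(1,2;n) lies in at most s members of a local realizer.
-- Every triple x < y < z has {x,z} ∥ {y}, so some member L puts {x,z} below {y};
-- colour the triple by the pair (rank of L among the members containing {y},
-- rank of L among the members containing {x,z}), one of s² colours.  In a
-- monochromatic quadruple a < b < c < d the triples abc and abd share {b},
-- abd and acd share {a,d}, and acd and bcd share {c}, so the equal ranks force a
-- single member L with {a,c} < {b} and {b,d} < {c}.  But then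
-- {b} ≤ {b,d} < {c} ≤ {a,c} < {b} in L, which is impossible.
module Submission where

open import Defs
open import Data.Nat using (ℕ; _≤_; _*_)

import Data.Nat as ℕ
import Data.Nat.Properties as ℕP
open import Data.Fin as Fin using (Fin; zero; suc; _<_; combine; inject≤)
open import Data.Fin.Properties
  using (<-trans; <-irrefl; <-irrelevant; ≤-antisym; ≤-refl; _<?_; any?; combine-injective; inject≤-injective; toℕ-injective)
open import Data.Fin.Subset using (Subset; _⊆_; ∣_∣; inside; outside; ⁅_⁆; ⋃)
  renaming (_∈_ to _∈ₛ_)
open import Data.Fin.Subset.Properties using (x∈⁅x⁆; x∈⁅y⁆⇒x≡y; x∈p∪q⁺; x∈p∪q⁻; ∉⊥)
open import Data.Vec using ([]; _∷_; here; there)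
open import Data.List using (List; []; _∷_; length; lookup; map)
import Data.List.Properties as ListP
import Data.List.Relation.Unary.All as All
open import Data.List.Relation.Unary.All using (All; []; _∷_)
import Data.List.Relation.Unary.All.Properties as AllP
open import Data.List.Relation.Unary.AllPairs using (AllPairs; []; _∷_)
import Data.List.Relation.Unary.AllPairs as AllPairs
import Data.List.Relation.Unary.AllPairs.Properties as AllPairsP
open import Data.List.Relation.Unary.Any using (here; there; index)
open import Data.List.Relation.Unary.Unique.Propositional using (Unique)
open import Data.List.Membership.Propositional using (_∈_)
open import Data.List.Membership.Propositional.Properties using (∈-lookup; ∈-map⁺; ∈-map⁻; ∈-filter⁺)
open import Data.List.Membership.Setoid.Properties using (index-injective)
import Data.List.Membership.DecPropositional as DecMem
open import Data.Product using (Σ-syntax; ∃; _×_; _,_; proj₁; proj₂)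
open import Data.Sum using (_⊎_; inj₁; inj₂)
open import Data.Empty using (⊥; ⊥-elim)
open import Function using (_∘_)
open import Relation.Nullary using (¬_; Dec; yes; no; contradiction)
open import Relation.Nullary.Decidable using (map′)
open import Relation.Binary.PropositionalEquality

private
  variable
    n r : ℕ

StrictlySorted : List (Fin n) → Set
StrictlySorted = AllPairs _<_

head-≤ : ∀ {x y} {ys : List (Fin n)} → StrictlySorted (y ∷ ys) → x ∈ y ∷ ys → y Fin.≤ x
head-≤ _ (here refl) = ≤-refl
head-≤ (y<ys ∷ _) (there x∈ys) = ℕP.<⇒≤ (All.lookup y<ys x∈ys)

tail-⊆ : ∀ {x y} {xs ys : List (Fin n)} → x ≡ y → All (x <_) xs →
  (∀ {z} → z ∈ x ∷ xs → z ∈ y ∷ ys) → ∀ {z} → z ∈ xs → z ∈ ys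
tail-⊆ refl x<xs ⊆ z∈xs with ⊆ (there z∈xs)
... | here refl = contradiction (All.lookup x<xs z∈xs) (<-irrefl refl)
... | there z∈ys = z∈ys

StrictlySorted-≡ : {xs ys : List (Fin n)} → StrictlySorted xs → StrictlySorted ys →
  (∀ {z} → z ∈ xs → z ∈ ys) → (∀ {z} → z ∈ ys → z ∈ xs) → xs ≡ ys
StrictlySorted-≡ {xs = []} {[]} _ _ _ _ = refl
StrictlySorted-≡ {xs = []} {_ ∷ _} _ _ _ ⊇ with ⊇ (here refl)
... | ()
StrictlySorted-≡ {xs = _ ∷ _} {[]} _ _ ⊆ _ with ⊆ (here refl)
... | ()
StrictlySorted-≡ {xs = x ∷ xs} {y ∷ ys} sxs@(x<xs ∷ sxs′) sys@(y<ys ∷ sys′) ⊆ ⊇ =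
  cong₂ _∷_ x≡y (StrictlySorted-≡ sxs′ sys′ (tail-⊆ x≡y x<xs ⊆) (tail-⊆ (sym x≡y) y<ys ⊇))
  where
  x≡y : x ≡ y
  x≡y = ≤-antisym (head-≤ sxs (⊇ (here refl))) (head-≤ sys (⊆ (here refl)))

elements : Subset n → List (Fin n)
elements [] = []
elements (inside ∷ p) = zero ∷ map suc (elements p)
elements (outside ∷ p) = map suc (elements p)

∣p∣≡length-elements : (p : Subset n) → ∣ p ∣ ≡ length (elements p)
∣p∣≡length-elements [] = refl
∣p∣≡length-elements (inside ∷ p) =
  cong ℕ.suc (trans (∣p∣≡length-elements p) (sym (ListP.length-map suc (elements p))))
∣p∣≡length-elements (outside ∷ p) =
  trans (∣p∣≡length-elements p) (sym (ListP.length-map suc (elements p)))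

elements-sorted : (p : Subset n) → StrictlySorted (elements p)
elements-sorted [] = []
elements-sorted (inside ∷ p) =
  AllP.map⁺ (All.universal (λ _ → ℕ.s≤s ℕ.z≤n) (elements p))
    ∷ AllPairsP.map⁺ (AllPairs.map ℕ.s≤s (elements-sorted p))
elements-sorted (outside ∷ p) = AllPairsP.map⁺ (AllPairs.map ℕ.s≤s (elements-sorted p))

∈-elements⁺ : ∀ {p : Subset n} {x} → x ∈ₛ p → x ∈ elements p
∈-elements⁺ {p = inside ∷ _} here = here refl
∈-elements⁺ {p = inside ∷ _} (there x∈p) = there (∈-map⁺ suc (∈-elements⁺ x∈p))
∈-elements⁺ {p = outside ∷ _} (there x∈p) = ∈-map⁺ suc (∈-elements⁺ x∈p)

∈-elements⁻ : ∀ {p : Subset n} {x} → x ∈ elements p → x ∈ₛ p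
∈-suc-elements⁻ : ∀ {p : Subset n} {b x} → x ∈ map suc (elements p) → x ∈ₛ b ∷ p

∈-elements⁻ {p = inside ∷ _} (here refl) = here
∈-elements⁻ {p = inside ∷ _} (there x∈) = ∈-suc-elements⁻ x∈
∈-elements⁻ {p = outside ∷ _} x∈ = ∈-suc-elements⁻ x∈

∈-suc-elements⁻ x∈ with ∈-map⁻ suc x∈
... | _ , y∈ , refl = there (∈-elements⁻ y∈)

fromList : List (Fin n) → Subset n
fromList xs = ⋃ (map ⁅_⁆ xs)

∈-fromList⁺ : ∀ {x} {xs : List (Fin n)} → x ∈ xs → x ∈ₛ fromList xs
∈-fromList⁺ (here refl) = x∈p∪q⁺ (inj₁ (x∈⁅x⁆ _))
∈-fromList⁺ (there x∈xs) = x∈p∪q⁺ (inj₂ (∈-fromList⁺ x∈xs))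

∈-fromList⁻ : ∀ {x} (xs : List (Fin n)) → x ∈ₛ fromList xs → x ∈ xs
∈-fromList⁻ [] x∈ = contradiction x∈ ∉⊥
∈-fromList⁻ (y ∷ xs) x∈ with x∈p∪q⁻ ⁅ y ⁆ (fromList xs) x∈
... | inj₁ x∈⁅y⁆ = here (x∈⁅y⁆⇒x≡y y x∈⁅y⁆)
... | inj₂ x∈xs = there (∈-fromList⁻ xs x∈xs)

elements-fromList : {xs : List (Fin n)} → StrictlySorted xs → elements (fromList xs) ≡ xs
elements-fromList {xs = xs} sorted = StrictlySorted-≡ (elements-sorted (fromList xs)) sorted
  (∈-fromList⁻ xs ∘ ∈-elements⁻) (∈-elements⁺ ∘ ∈-fromList⁺)

TripleColouring : ℕ → ℕ → Set
TripleColouring n r = ∀ {x y z : Fin n} → x < y → y < z → Fin r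

record MonochromaticQuadruple (χ : TripleColouring n r) : Set where
  field
    {a b c d} : Fin n
    a<b : a < b
    b<c : b < c
    c<d : c < d
    colour : Fin r
    colour-abc : χ a<b b<c ≡ colour
    colour-abd : χ a<b (<-trans b<c c<d) ≡ colour
    colour-acd : χ (<-trans a<b b<c) c<d ≡ colour
    colour-bcd : χ b<c c<d ≡ colour

module _ (χ : TripleColouring n r) where

  colourSorted : (xs : List (Fin n)) → StrictlySorted xs → length xs ≡ 3 → Fin r
  colourSorted (_ ∷ _ ∷ _ ∷ []) ((x<y ∷ _) ∷ (y<z ∷ []) ∷ _) _ = χ x<y y<z
  colourSorted [] _ ()
  colourSorted (_ ∷ []) _ ()
  colourSorted (_ ∷ _ ∷ []) _ ()
  colourSorted (_ ∷ _ ∷ _ ∷ _ ∷ _) _ ()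

  subsetColouring : Colouring n 3 r
  subsetColouring A ∣A∣≡3 =
    colourSorted (elements A) (elements-sorted A) (trans (sym (∣p∣≡length-elements A)) ∣A∣≡3)

  colourSorted-≡ : ∀ {x y z} {xs} (sorted : StrictlySorted xs) (len : length xs ≡ 3) →
    xs ≡ x ∷ y ∷ z ∷ [] → (x<y : x < y) (y<z : y < z) → colourSorted xs sorted len ≡ χ x<y y<z
  colourSorted-≡ ((p ∷ _) ∷ (q ∷ []) ∷ _) _ refl x<y y<z =
    cong₂ (λ p q → χ p q) (<-irrelevant p x<y) (<-irrelevant q y<z)

monochromatic-quadruple : ∀ {N} → RamseyProp 3 4 r N → N ≤ n →
  (χ : TripleColouring n r) → MonochromaticQuadruple χ
monochromatic-quadruple {n = n} ramsey N≤n χ with ramsey n N≤n (subsetColouring χ)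
... | H , ∣H∣≡4 , colour , mono =
  quadruple (elements H) (elements-sorted H) (trans (sym (∣p∣≡length-elements H)) ∣H∣≡4) ∈-elements⁻
  where
  triple : ∀ {x y z} (x<y : x < y) (y<z : y < z) → x ∈ₛ H → y ∈ₛ H → z ∈ₛ H → χ x<y y<z ≡ colour
  triple {x} {y} {z} x<y y<z x∈H y∈H z∈H =
    trans (sym (colourSorted-≡ χ (elements-sorted A) _ A≡xyz x<y y<z)) (mono A ∣A∣≡3 A⊆H)
    where
    A = fromList (x ∷ y ∷ z ∷ [])
    A≡xyz : elements A ≡ x ∷ y ∷ z ∷ []
    A≡xyz = elements-fromList ((x<y ∷ <-trans x<y y<z ∷ []) ∷ (y<z ∷ []) ∷ [] ∷ [])
    ∣A∣≡3 : ∣ A ∣ ≡ 3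
    ∣A∣≡3 = trans (∣p∣≡length-elements A) (cong length A≡xyz)
    A⊆H : A ⊆ H
    A⊆H w∈A with ∈-fromList⁻ (x ∷ y ∷ z ∷ []) w∈A
    ... | here refl = x∈H
    ... | there (here refl) = y∈H
    ... | there (there (here refl)) = z∈H

  quadruple : (xs : List (Fin n)) → StrictlySorted xs → length xs ≡ 4 →
    (∀ {x} → x ∈ xs → x ∈ₛ H) → MonochromaticQuadruple χ
  quadruple (_ ∷ _ ∷ _ ∷ _ ∷ []) ((a<b ∷ _) ∷ (b<c ∷ _) ∷ (c<d ∷ []) ∷ [] ∷ []) _ ∈H = record
    { a<b = a<b ; b<c = b<c ; c<d = c<d ; colour = colour
    ; colour-abc = triple a<b b<c a∈ b∈ c∈
    ; colour-abd = triple a<b (<-trans b<c c<d) a∈ b∈ d∈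
    ; colour-acd = triple (<-trans a<b b<c) c<d a∈ c∈ d∈
    ; colour-bcd = triple b<c c<d b∈ c∈ d∈
    }
    where
    a∈ = ∈H (here refl)
    b∈ = ∈H (there (here refl))
    c∈ = ∈H (there (there (here refl)))
    d∈ = ∈H (there (there (there (here refl))))
  quadruple [] _ ()
  quadruple (_ ∷ []) _ ()
  quadruple (_ ∷ _ ∷ []) _ ()
  quadruple (_ ∷ _ ∷ _ ∷ []) _ ()
  quadruple (_ ∷ _ ∷ _ ∷ _ ∷ _ ∷ _) _ ()

lookup-injective : ∀ {A : Set} {xs : List A} → Unique xs →
  (i j : Fin (length xs)) → lookup xs i ≡ lookup xs j → i ≡ j
lookup-injective (_ ∷ _) zero zero _ = refl
lookup-injective (x≢xs ∷ _) zero (suc j) eq = contradiction eq (All.lookup x≢xs (∈-lookup j))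
lookup-injective (x≢xs ∷ _) (suc i) zero eq = contradiction (sym eq) (All.lookup x≢xs (∈-lookup i))
lookup-injective (_ ∷ xs!) (suc i) (suc j) eq = cong suc (lookup-injective xs! i j eq)

module _ {xs : List (Elem n)} where

  ≤[]-∈ˡ : ∀ {x y} → x ≤[ xs ] y → x ∈ xs
  ≤[]-∈ˡ (i , _ , _ , refl , _) = ∈-lookup i

  ≤[]-∈ʳ : ∀ {x y} → x ≤[ xs ] y → y ∈ xs
  ≤[]-∈ʳ (_ , j , _ , _ , refl) = ∈-lookup j

  ≤[]-trans : Unique xs → ∀ {x y z} → x ≤[ xs ] y → y ≤[ xs ] z → x ≤[ xs ] z
  ≤[]-trans xs! (i , j , i≤j , x≡ , y≡) (j′ , k , j′≤k , y≡′ , z≡)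
    with refl ← lookup-injective xs! j j′ (trans y≡ (sym y≡′)) =
    i , k , ℕP.≤-trans i≤j j′≤k , x≡ , z≡

  ≤[]-antisym : Unique xs → ∀ {x y} → x ≤[ xs ] y → y ≤[ xs ] x → x ≡ y
  ≤[]-antisym xs! (i , j , i≤j , refl , refl) (j′ , i′ , j′≤i′ , y≡ , x≡)
    with refl ← lookup-injective xs! j j′ (sym y≡)
       | refl ← lookup-injective xs! i i′ (sym x≡) =
    cong (lookup xs) (toℕ-injective (ℕP.≤-antisym i≤j j′≤i′))

crossing-impossible : (L : PLE n) {a b c d : Fin n} {a<c : a < c} {b<d : b < d} →
  pr a c a<c ≤[ elems L ] pt b → pr b d b<d ≤[ elems L ] pt c → ⊥
crossing-impossible L ac≤b bd≤c = pt≢pr (≤[]-antisym (unique L) b≤bd bd≤b)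
  where
  pt≢pr : ∀ {i j k} {j<k : j < k} → pt i ≢ pr j k j<k
  pt≢pr ()
  b≤bd = extends L _ _ (≤[]-∈ʳ ac≤b) (≤[]-∈ˡ bd≤c) (inj₁ refl)
  c≤ac = extends L _ _ (≤[]-∈ʳ bd≤c) (≤[]-∈ˡ ac≤b) (inj₂ refl)
  bd≤b = ≤[]-trans (unique L) bd≤c (≤[]-trans (unique L) c≤ac ac≤b)

module _ (𝓛 : List (PLE n)) where
  open DecMem (_≟E_ {n}) using (_∈?_)

  rank : (u : Elem n) {L : PLE n} → L ∈ 𝓛 → u ∈ elems L → Fin (μ u 𝓛)
  rank u L∈𝓛 u∈L = index (∈-filter⁺ (λ L → u ∈? elems L) L∈𝓛 u∈L)

  rank-injective : (u : Elem n) {L₁ L₂ : PLE n} (L₁∈𝓛 : L₁ ∈ 𝓛) (L₂∈𝓛 : L₂ ∈ 𝓛)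
    (u∈L₁ : u ∈ elems L₁) (u∈L₂ : u ∈ elems L₂) →
    rank u L₁∈𝓛 u∈L₁ ≡ rank u L₂∈𝓛 u∈L₂ → L₁ ≡ L₂
  rank-injective _ _ _ _ _ = index-injective (setoid (PLE n)) _ _

module _ {𝓛 : List (PLE n)} (realizer : LocalRealizer 𝓛) {s : ℕ} (μ≤s : ∀ u → μ u 𝓛 ≤ s) where
  open LocalRealizer realizer

  Below : Elem n → Elem n → Set
  Below v u = Σ[ L ∈ PLE n ] L ∈ 𝓛 × v ≤[ elems L ] u

  upperRank : ∀ {u v} → Below v u → Fin s
  upperRank {u} (_ , L∈𝓛 , v≤u) = inject≤ (rank 𝓛 u L∈𝓛 (≤[]-∈ʳ v≤u)) (μ≤s u)

  lowerRank : ∀ {u v} → Below v u → Fin s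
  lowerRank {v = v} (_ , L∈𝓛 , v≤u) = inject≤ (rank 𝓛 v L∈𝓛 (≤[]-∈ˡ v≤u)) (μ≤s v)

  upperRank-injective : ∀ {u v v′} (w : Below v u) (w′ : Below v′ u) →
    upperRank w ≡ upperRank w′ → proj₁ w ≡ proj₁ w′
  upperRank-injective {u} (_ , L∈𝓛 , v≤u) (_ , L′∈𝓛 , v′≤u) eq =
    rank-injective 𝓛 u L∈𝓛 L′∈𝓛 (≤[]-∈ʳ v≤u) (≤[]-∈ʳ v′≤u) (inject≤-injective _ _ _ _ eq)

  lowerRank-injective : ∀ {u u′ v v′} → v ≡ v′ → (w : Below v u) (w′ : Below v′ u′) →
    lowerRank w ≡ lowerRank w′ → proj₁ w ≡ proj₁ w′
  lowerRank-injective {v = v} refl (_ , L∈𝓛 , v≤u) (_ , L′∈𝓛 , v≤u′) eq =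
    rank-injective 𝓛 v L∈𝓛 L′∈𝓛 (≤[]-∈ˡ v≤u) (≤[]-∈ˡ v≤u′) (inject≤-injective _ _ _ _ eq)

  below : ∀ {x y z} (x<y : x < y) (y<z : y < z) → Below (pr x z (<-trans x<y y<z)) (pt y)
  below x<y y<z = realizes∥ (pt _) (pr _ _ _) (y∉xz , λ ())
    where
    y∉xz : ¬ (_ ≡ _ ⊎ _ ≡ _)
    y∉xz (inj₁ refl) = <-irrefl refl x<y
    y∉xz (inj₂ refl) = <-irrefl refl y<z

  rankColouring : TripleColouring n (s * s)
  rankColouring x<y y<z = combine (upperRank (below x<y y<z)) (lowerRank (below x<y y<z))

  sameColour⇒sameRanks : ∀ {x y z x′ y′ z′} (x<y : x < y) (y<z : y < z) (x′<y′ : x′ < y′) (y′<z′ : y′ < z′) →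
    rankColouring x<y y<z ≡ rankColouring x′<y′ y′<z′ →
    upperRank (below x<y y<z) ≡ upperRank (below x′<y′ y′<z′) ×
    lowerRank (below x<y y<z) ≡ lowerRank (below x′<y′ y′<z′)
  sameColour⇒sameRanks x<y y<z x′<y′ y′<z′ = combine-injective
    (upperRank (below x<y y<z)) (lowerRank (below x<y y<z))
    (upperRank (below x′<y′ y′<z′)) (lowerRank (below x′<y′ y′<z′))

  no-monochromatic-quadruple : ¬ MonochromaticQuadruple rankColouring
  no-monochromatic-quadruple q =
    crossing-impossible (proj₁ abc) (proj₂ (proj₂ abc))
      (subst (λ L → _ ≤[ elems L ] _) (sym abc≡bcd) (proj₂ (proj₂ bcd)))
    where
    open MonochromaticQuadruple q
    abc = below a<b b<c
    abd = below a<b (<-trans b<c c<d)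
    acd = below (<-trans a<b b<c) c<d
    bcd = below b<c c<d
    abc≡abd : proj₁ abc ≡ proj₁ abd
    abc≡abd = upperRank-injective abc abd
      (proj₁ (sameColour⇒sameRanks _ _ _ _ (trans colour-abc (sym colour-abd))))
    abd≡acd : proj₁ abd ≡ proj₁ acd
    abd≡acd = lowerRank-injective (cong (pr _ _) (<-irrelevant _ _)) abd acd
      (proj₂ (sameColour⇒sameRanks _ _ _ _ (trans colour-abd (sym colour-acd))))
    acd≡bcd : proj₁ acd ≡ proj₁ bcd
    acd≡bcd = upperRank-injective acd bcd
      (proj₁ (sameColour⇒sameRanks _ _ _ _ (trans colour-acd (sym colour-bcd))))
    abc≡bcd : proj₁ abc ≡ proj₁ bcd
    abc≡bcd = trans abc≡abd (trans abd≡acd acd≡bcd)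

any-pr? : {P : Elem n → Set} → (∀ u → Dec (P u)) →
  Dec (∃ λ i → ∃ λ j → Σ[ i<j ∈ i < j ] P (pr i j i<j))
any-pr? {P = P} P? = any? λ i → any? λ j → pair? i j
  where
  pair? : ∀ i j → Dec (Σ[ i<j ∈ i < j ] P (pr i j i<j))
  pair? i j with i <? j
  ... | no i≮j = no (i≮j ∘ proj₁)
  ... | yes i<j = map′ (i<j ,_)
    (λ (i<j′ , P[ij]) → subst (P ∘ pr i j) (<-irrelevant i<j′ i<j) P[ij]) (P? (pr i j i<j))

any-Elem? : {P : Elem n → Set} → (∀ u → Dec (P u)) → Dec (∃ P)
any-Elem? P? with any? (P? ∘ pt) | any-pr? P?
... | yes (i , P[i]) | _ = yes (pt i , P[i])
... | no _ | yes (i , j , i<j , P[ij]) = yes (pr i j i<j , P[ij])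
... | no ¬pt | no ¬pr = no λ
  { (pt i , P[i]) → ¬pt (i , P[i])
  ; (pr i j i<j , P[ij]) → ¬pr (i , j , i<j , P[ij]) }

theorem2p4 : (s : ℕ) → 1 ≤ s → (N : ℕ) → IsRam 3 4 (s * s) N →
    (n : ℕ) → N ≤ n → ldim12> n s
theorem2p4 s _ N (_ , ramsey , _) n N≤n 𝓛 realizer with any-Elem? (λ u → s ℕ.<? μ u 𝓛)
... | yes overloaded = overloaded
... | no none = ⊥-elim (no-monochromatic-quadruple realizer μ≤s
                 (monochromatic-quadruple ramsey N≤n (rankColouring realizer μ≤s)))
  where
  μ≤s : ∀ u → μ u 𝓛 ≤ s
  μ≤s u = ℕP.≮⇒≥ (λ s<μ → none (u , s<μ))
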